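{- Let $n\ge2$, $m\ge1$ be integers and let $i$ be a positive integer, with $i$ even if $n$ is even ($i$ arbitrary if $n$ is odd). Let $\mathfrak{X}\subset\mathbb{R}^{nm}$ be a set of the form described in the context. If each vector in $\mathfrak{X}$ can be added to $\tilde{H}(n,m)$ while maintaining $m$-distance, then each vector in the set $\{(\mathbf{x},\mathbf{u},\ldots,\mathbf{u}):\mathbf{x}\in\mathfrak{X}\}\subset\mathbb{R}^{n(m+in)}$, where $\mathbf{u}=(1/n,\ldots,1/n)\in\mathbb{R}^n$ is repeated $in$ times, can be added to $\tilde{H}(n,m+in)$ while maintaining $(m+in)$-distance.
   Context: $\tilde{H}(n,m)=\{\sum_{i=1}^m\mathbf{e}_{(i-1)n+x_i}:(x_1,\ldots,x_m)\in\{1,\ldots,n\}^m\}\subset\mathbb{R}^{mn}$ (standard basis $\mathbf{e}_k$); it is an $m$-distance set with distances $\sqrt2,\ldots,\sqrt{2m}$. A vector $\mathbf{x}$ "can be added to $\tilde H(n,m)$ while maintaining $m$-distance" if $\tilde H(n,m)\cup\{\mathbf{x}\}$ is still an $m$-distance set (exactly $m$ distinct distances between distinct points). The set $\mathfrak{X}$: for each $j\in\{1,\ldots,m\}$ take an integer $t_j\ge1$ and nonnegative integers $k_1^{(j)},\ldots,k_{t_j}^{(j)}$ summing to $n$, put $k_0^{(j)}=1+\sum_{i}(i-1)k_i^{(j)}$, let $\mathfrak{x}_j\subset\mathbb{R}^n$ be the set of all coordinate permutations of the vector with $k_i^{(j)}$ entries equal to $k_0^{(j)}/n-i+1$ ($i=1,\ldots,t_j$),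 and $\mathfrak{X}=\mathfrak{x}_1\times\cdots\times\mathfrak{x}_m$. -}

module Defs where

open import Data.Nat as ℕ using (ℕ; zero; suc)
open import Data.Integer using (+_)
open import Data.Rational using (ℚ; 0ℚ; 1ℚ; _/_; _+_; _-_; _*_)
open import Data.Fin using (Fin; toℕ)
open import Data.Vec using (Vec; []; _∷_; tabulate; toList)
open import Data.List using (List; length; concat; replicate; upTo; zipWith)
open import Data.List.Membership.Propositional using (_∈_)
open import Data.List.Relation.Unary.Unique.Propositional using (Unique)
open import Data.List.Relation.Binary.Permutation.Propositional using (_↭_)
open import Data.Product using (Σ; ∃; _×_)
open import Data.Sum using (_⊎_)
open import Relation.Binary.PropositionalEquality using (_≡_; _≢_)
open import Relation.Nullary using (Dec; yes; no)
open import Function.Bundles using (_⇔_)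

-- A point of ℝ^{mn} (all relevant points have rational coordinates) is
-- stored as m blocks of length n: the coordinate (j-1)n + k is block j, entry k.
Point : ℕ → ℕ → Set
Point n m = Vec (Vec ℚ n) m

sqdistBlock : ∀ {n} → Vec ℚ n → Vec ℚ n → ℚ
sqdistBlock [] [] = 0ℚ
sqdistBlock (a ∷ as) (b ∷ bs) = (a - b) * (a - b) + sqdistBlock as bs

sqdist : ∀ {n m} → Point n m → Point n m → ℚ
sqdist [] [] = 0ℚ
sqdist (p ∷ ps) (q ∷ qs) = sqdistBlock p q + sqdist ps qs

-- Ĥ(n,m): points Σ_j e_{(j-1)n + x_j}
hvec : ∀ n m → (Fin m → Fin n) → Point n m
hvec n m x = tabulate λ j → tabulate λ k → indicator (x j) k
  where
  indicator : Fin n → Fin n → ℚ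
  indicator a b with a Data.Fin.≟ b
  ... | yes _ = 1ℚ
  ... | no _ = 0ℚ

InH : ∀ n m → Point n m → Set
InH n m p = ∃ λ (x : Fin m → Fin n) → hvec n m x ≡ p

IsDist : ∀ {n m} → (Point n m → Set) → ℚ → Set
IsDist S r = ∃ λ p → ∃ λ q → S p × S q × p ≢ q × sqdist p q ≡ r

-- S is an s-distance set: exactly s distinct distances occur between distinct
-- points (distances compared via their squares, which is equivalent).
IsSDistanceSet : ∀ {n m} → ℕ → (Point n m → Set) → Set
IsSDistanceSet s S =
  Σ (List ℚ) λ ds → length ds ≡ s × Unique ds × (∀ r → IsDist S r ⇔ r ∈ ds)

CanAdd : ∀ n m → Point n m → Set
CanAdd n m x = IsSDistanceSet m (λ p → InH n m p ⊎ p ≡ x)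

-- a / n in ℚ (n is ≥ 2 wherever this is used)
divℕ : ℕ → ℕ → ℚ
divℕ a zero = 0ℚ
divℕ a (suc n) = (+ a) / suc n

-- Σ_{p < t} p * k_p   (p = i - 1 with i = 1..t)
weighted : ∀ {t} → Vec ℕ t → ℕ
weighted ks = go 0 ks
  where
  go : ∀ {t} → ℕ → Vec ℕ t → ℕ
  go p [] = 0
  go p (k ∷ ks) = p ℕ.* k ℕ.+ go (suc p) ks

k0 : ∀ {t} → Vec ℕ t → ℕ
k0 ks = suc (weighted ks)

-- entries of the base vector: k_i copies of k_0/n - i + 1, for i = 1..t
baseEntries : ∀ {t} → ℕ → Vec ℕ t → List ℚ
baseEntries {t} n ks = go 0 ks
  where
  c : ℚ
  c = divℕ (k0 ks) n
  go : ∀ {t'} → ℕ → Vec ℕ t' → List ℚ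
  go p [] = Data.List.[]
  go p (k ∷ rest) = replicate k (c - ((+ p) / 1)) Data.List.++ go (suc p) rest

InXj : ∀ n {t} → Vec ℕ t → Vec ℚ n → Set
InXj n ks v = toList v ↭ baseEntries n ks

InX : ∀ n m (t : Fin m → ℕ) → ((j : Fin m) → Vec ℕ (t j)) → Point n m → Set
InX n m t k x = ∀ j → InXj n (k j) (Data.Vec.lookup x j)

uvec : ∀ n → Vec ℚ n
uvec n = Data.Vec.replicate n (divℕ 1 n)

-- Ĥ(n,m) itself realises the m squared distances 2, 4, …, 2m, so if x can be
-- added, the squared distance from x to every point of Ĥ(n,m) lies in {0, 2, …, 2m}. A block
-- u = (1/n, …, 1/n) is at squared distance 1 − 1/n from every unit vector, so the i n blocks u
-- are at squared distance i (n − 1) = 2b from every point of Ĥ(n, i n), with b an integer by the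
-- parity hypothesis. Hence (x, u, …, u) is at squared distance 2(c + b), 1 ≤ c + b ≤ m + i n,
-- from every point of Ĥ(n, m + i n): no distance beyond those of Ĥ(n, m + i n) appears.
module Submission where

open import Defs
open import Data.Nat using (ℕ; _≤_; _+_; _*_)
open import Data.Nat.Divisibility using (_∣_)
open import Data.Fin using (Fin)
open import Data.Vec using (Vec; _++_; replicate; sum)
open import Relation.Binary.PropositionalEquality using (_≡_)

open import Algebra.Bundles using (CommutativeRing)
import Algebra.Properties.Semiring.Mult
open import Data.Empty using (⊥-elim)
open import Data.Fin as F using (zero; suc; _↑ˡ_; _↑ʳ_)
open import Data.Integer as ℤ using (+_)
import Data.Integer.Properties as ℤP
open import Data.List as L using (List; []; _∷_; length; upTo)
import Data.List.Properties as LP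
open import Data.List.Membership.Propositional using (_∈_; _─_)
open import Data.List.Membership.Propositional.Properties using (∈-map⁺; ∈-map⁻; ∈-upTo⁺; ∈-upTo⁻)
open import Data.List.Relation.Binary.Subset.Propositional using (_⊆_)
import Data.List.Relation.Unary.All as All
open import Data.List.Relation.Unary.All.Properties using (¬Any⇒All¬)
open import Data.List.Relation.Unary.AllPairs using (_∷_)
open import Data.List.Relation.Unary.Any using (here; there; any?; index)
open import Data.List.Relation.Unary.Unique.Propositional using (Unique)
import Data.List.Relation.Unary.Unique.Propositional.Properties as Unique
open import Data.Nat using (zero; suc; z≤n; s≤s)
import Data.Nat.Coprimality as Coprime
open import Data.Nat.Divisibility using (divides; ∣m⇒∣m*n; ∣n⇒∣m*n)
import Data.Nat.Properties as ℕP
open import Data.Product using (∃; _×_; _,_)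
open import Data.Rational as ℚ using (ℚ; 0ℚ; 1ℚ; mkℚ; ↥_)
import Data.Rational.Properties as ℚP
open import Data.Rational.Solver using (module +-*-Solver)
import Data.Rational.Unnormalised as ℚᵘ
import Data.Rational.Unnormalised.Properties as ℚᵘP
open import Data.Sum using (_⊎_; inj₁; inj₂)
open import Data.Vec as V using ([]; _∷_; tabulate)
import Data.Vec.Properties as VP
open import Function using (_∘_; _∋_; const; mk⇔; Equivalence)
open import Relation.Binary.Definitions using (DecidableEquality)
open import Relation.Binary.PropositionalEquality
  using (_≢_; refl; sym; trans; cong; cong₂; subst; _≗_; module ≡-Reasoning)
open import Relation.Nullary using (yes; no)

private
  module Mult = Algebra.Properties.Semiring.Mult (CommutativeRing.semiring ℚP.+-*-commutativeRing)

fromℕ : ℕ → ℚ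
fromℕ k = k Mult.× 1ℚ

normalForm : ℕ → ℚ
normalForm k = mkℚ (+ k) 0 (Coprime.sym (Coprime.1-coprimeTo k))

1+normalForm : ∀ k → 1ℚ ℚ.+ normalForm k ≡ normalForm (suc k)
1+normalForm k =
  ℚP.toℚᵘ-injective (ℚᵘP.≃-trans (ℚP.toℚᵘ-homo-+ 1ℚ (normalForm k)) (ℚᵘ.*≡* (begin
  (+ 1 ℤ.+ + k ℤ.* + 1) ℤ.* + 1  ≡⟨ ℤP.*-identityʳ _ ⟩
  + 1 ℤ.+ + k ℤ.* + 1            ≡⟨ cong (ℤ._+_ (+ 1)) (ℤP.*-identityʳ (+ k)) ⟩
  + suc k                        ≡⟨ ℤP.*-identityʳ (+ suc k) ⟨
  + suc k ℤ.* + 1                ∎)))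
  where open ≡-Reasoning

fromℕ≡normalForm : ∀ k → fromℕ k ≡ normalForm k
fromℕ≡normalForm zero    = refl
fromℕ≡normalForm (suc k) = trans (cong (1ℚ ℚ.+_) (fromℕ≡normalForm k)) (1+normalForm k)

fromℕ-injective : ∀ {a b} → fromℕ a ≡ fromℕ b → a ≡ b
fromℕ-injective {a} {b} eq =
  ℤP.+-injective (cong ↥_ (trans (sym (fromℕ≡normalForm a)) (trans eq (fromℕ≡normalForm b))))

fromℕ-+ : ∀ a b → fromℕ (a + b) ≡ fromℕ a ℚ.+ fromℕ b
fromℕ-+ = Mult.×-homo-+ 1ℚ

fromℕ-* : ∀ a b → fromℕ (a * b) ≡ fromℕ a ℚ.* fromℕ b
fromℕ-* = Mult.×1-homo-*

fromℕ-*-divℕ : ∀ n → fromℕ (suc n) ℚ.* divℕ 1 (suc n) ≡ 1ℚ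
fromℕ-*-divℕ n
  rewrite fromℕ≡normalForm (suc n) | ℚP.normalize-coprime {1} {n} (Coprime.1-coprimeTo (suc n)) =
  ℚP.*-inverseʳ (normalForm (suc n))

fromℕ-double-injective : ∀ {a b} → fromℕ (2 * a) ≡ fromℕ (2 * b) → a ≡ b
fromℕ-double-injective eq = ℕP.*-cancelˡ-≡ _ _ 2 (fromℕ-injective eq)

fromℕ-double-+ : ∀ a b → fromℕ (2 * a) ℚ.+ fromℕ (2 * b) ≡ fromℕ (2 * (a + b))
fromℕ-double-+ a b = sym (trans (cong fromℕ (ℕP.*-distribˡ-+ 2 a b)) (fromℕ-+ (2 * a) (2 * b)))

module _ {A : Set} where

  ∈-─ : ∀ {x y : A} {ys} (x∈ys : x ∈ ys) → y ∈ ys → y ≢ x → y ∈ ys ─ x∈ys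
  ∈-─ (here refl)  (here refl)  y≢x = ⊥-elim (y≢x refl)
  ∈-─ (here refl)  (there y∈ys) _   = y∈ys
  ∈-─ (there _)    (here y≡z)   _   = here y≡z
  ∈-─ (there x∈ys) (there y∈ys) y≢x = there (∈-─ x∈ys y∈ys y≢x)

  unique-⊆⇒length≤ : ∀ {xs ys : List A} → Unique xs → xs ⊆ ys → length xs ≤ length ys
  unique-⊆⇒length≤ {[]}     _              _     = z≤n
  unique-⊆⇒length≤ {x ∷ xs} {ys} (x∉xs ∷ !xs) xs⊆ys =
    subst (suc (length xs) ≤_) (sym (LP.length-removeAt′ ys (index x∈ys)))
      (s≤s (unique-⊆⇒length≤ !xs xs⊆ys─x))
    where
    x∈ys : x ∈ ys
    x∈ys = xs⊆ys (here refl)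
    xs⊆ys─x : xs ⊆ ys ─ x∈ys
    xs⊆ys─x y∈xs = ∈-─ x∈ys (xs⊆ys (there y∈xs)) (λ { refl → All.lookup x∉xs y∈xs refl })

  unique-⊆∧length≤⇒⊇ : DecidableEquality A → ∀ {xs ys : List A} →
    Unique xs → length ys ≤ length xs → xs ⊆ ys → ys ⊆ xs
  unique-⊆∧length≤⇒⊇ _≟_ {xs} {ys} !xs ys≤xs xs⊆ys {y} y∈ys with any? (y ≟_) xs
  ... | yes y∈xs = y∈xs
  ... | no  y∉xs =
    ⊥-elim (ℕP.<-irrefl refl (ℕP.≤-trans (unique-⊆⇒length≤ (¬Any⇒All¬ xs y∉xs ∷ !xs) y∷xs⊆ys) ys≤xs))
    where
    y∷xs⊆ys : y ∷ xs ⊆ ys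
    y∷xs⊆ys (here refl)  = y∈ys
    y∷xs⊆ys (there z∈xs) = xs⊆ys z∈xs

tabulate-++ : ∀ {A : Set} m {k} (f : Fin (m + k) → A) →
  tabulate f ≡ tabulate (f ∘ (_↑ˡ k)) ++ tabulate (f ∘ (m ↑ʳ_))
tabulate-++ zero    f = refl
tabulate-++ (suc m) f = cong (f zero ∷_) (tabulate-++ m (f ∘ suc))

IsDist-mono : ∀ {n m} {S T : Point n m → Set} → (∀ {p} → S p → T p) →
  ∀ {r} → IsDist S r → IsDist T r
IsDist-mono S⊆T (p , q , Sp , Sq , p≢q , pq≡r) = p , q , S⊆T Sp , S⊆T Sq , p≢q , pq≡r

IsSDistanceSet-⊆ : ∀ {n m s} {S : Point n m → Set} → IsSDistanceSet s S →
  ∀ {D} → Unique D → length D ≡ s → (∀ {r} → r ∈ D → IsDist S r) →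
  ∀ {r} → IsDist S r → r ∈ D
IsSDistanceSet-⊆ (ds , |ds|≡s , _ , dist⇔ds) !D |D|≡s D-realised dist =
  unique-⊆∧length≤⇒⊇ ℚP._≟_ !D (ℕP.≤-reflexive (trans |ds|≡s (sym |D|≡s)))
    (λ r∈D → Equivalence.to (dist⇔ds _) (D-realised r∈D)) (Equivalence.to (dist⇔ds _) dist)

sqdistBlock-self : ∀ {n} (v : Vec ℚ n) → sqdistBlock v v ≡ 0ℚ
sqdistBlock-self []      = refl
sqdistBlock-self (a ∷ v) rewrite ℚP.+-inverseʳ a | sqdistBlock-self v = refl

sqdist-self : ∀ {n m} (p : Point n m) → sqdist p p ≡ 0ℚ
sqdist-self []      = refl
sqdist-self (v ∷ p) rewrite sqdistBlock-self v | sqdist-self p = refl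

sqdistBlock-sym : ∀ {n} (v w : Vec ℚ n) → sqdistBlock v w ≡ sqdistBlock w v
sqdistBlock-sym []      []      = refl
sqdistBlock-sym (a ∷ v) (b ∷ w) = cong₂ ℚ._+_
  (solve 2 (λ a b → (a :- b) :* (a :- b) := (b :- a) :* (b :- a)) refl a b) (sqdistBlock-sym v w)
  where open +-*-Solver

sqdist-sym : ∀ {n m} (p q : Point n m) → sqdist p q ≡ sqdist q p
sqdist-sym []      []      = refl
sqdist-sym (v ∷ p) (w ∷ q) = cong₂ ℚ._+_ (sqdistBlock-sym v w) (sqdist-sym p q)

sqdist-++ : ∀ {n m k} (p q : Point n m) (p′ q′ : Point n k) →
  sqdist (p ++ p′) (q ++ q′) ≡ sqdist p q ℚ.+ sqdist p′ q′
sqdist-++ []      []      p′ q′ = sym (ℚP.+-identityˡ _)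
sqdist-++ (v ∷ p) (w ∷ q) p′ q′ =
  trans (cong (sqdistBlock v w ℚ.+_) (sqdist-++ p q p′ q′))
        (sym (ℚP.+-assoc (sqdistBlock v w) (sqdist p q) (sqdist p′ q′)))

sqdistBlock-replicate : ∀ n q r →
  sqdistBlock (replicate n q) (replicate n r) ≡ fromℕ n ℚ.* ((q ℚ.- r) ℚ.* (q ℚ.- r))
sqdistBlock-replicate zero    q r = sym (ℚP.*-zeroˡ ((q ℚ.- r) ℚ.* (q ℚ.- r)))
sqdistBlock-replicate (suc n) q r = begin
  d ℚ.+ sqdistBlock (replicate n q) (replicate n r)
    ≡⟨ cong (d ℚ.+_) (sqdistBlock-replicate n q r) ⟩
  d ℚ.+ fromℕ n ℚ.* d
    ≡⟨ solve 2 (λ d x → d :+ x :* d := (con 1ℚ :+ x) :* d) refl d (fromℕ n) ⟩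
  (1ℚ ℚ.+ fromℕ n) ℚ.* d ∎
  where
  open ≡-Reasoning
  open +-*-Solver
  d = (q ℚ.- r) ℚ.* (q ℚ.- r)

unitVec : ∀ {n} → Fin n → Vec ℚ n
unitVec {suc n} zero = 1ℚ ∷ replicate n 0ℚ
unitVec (suc a)      = 0ℚ ∷ unitVec a

lookup-unitVec-≡ : ∀ {n} (a : Fin n) → V.lookup (unitVec a) a ≡ 1ℚ
lookup-unitVec-≡ zero    = refl
lookup-unitVec-≡ (suc a) = lookup-unitVec-≡ a

lookup-unitVec-≢ : ∀ {n} {a b : Fin n} → a ≢ b → V.lookup (unitVec a) b ≡ 0ℚ
lookup-unitVec-≢ {a = zero}  {zero}  a≢b = ⊥-elim (a≢b refl)
lookup-unitVec-≢ {a = zero}  {suc b} _   = VP.lookup-replicate b 0ℚ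
lookup-unitVec-≢ {a = suc a} {zero}  _   = refl
lookup-unitVec-≢ {a = suc a} {suc b} a≢b = lookup-unitVec-≢ (a≢b ∘ cong suc)

hvec≡tabulate-unitVec : ∀ n m x → hvec n m x ≡ tabulate (unitVec ∘ x)
hvec≡tabulate-unitVec n m x = trans (sym (VP.tabulate∘lookup (hvec n m x))) (VP.tabulate-cong row)
  where
  -- The entries of hvec come from a function local to its where-block; the ascribed
  -- equation unfolds hvec to expose it, so that the with can split on its test.
  entry : ∀ j k → V.lookup (V.lookup (hvec n m x) j) k ≡ V.lookup (unitVec (x j)) k
  entry j k rewrite (V.lookup (V.lookup (hvec n m x) j) k ≡ _) ∋
                      trans (cong (λ v → V.lookup v k) (VP.lookup∘tabulate _ j)) (VP.lookup∘tabulate _ k)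
            with x j F.≟ k
  ... | yes refl = sym (lookup-unitVec-≡ (x j))
  ... | no  xj≢k = sym (lookup-unitVec-≢ xj≢k)
  row : ∀ j → V.lookup (hvec n m x) j ≡ unitVec (x j)
  row j = trans (sym (VP.tabulate∘lookup _)) (trans (VP.tabulate-cong (entry j)) (VP.tabulate∘lookup _))

sqdistBlock-replicate-unitVec : ∀ {n} q (a : Fin (suc n)) →
  sqdistBlock (replicate (suc n) q) (unitVec a)
    ≡ (q ℚ.- 1ℚ) ℚ.* (q ℚ.- 1ℚ) ℚ.+ fromℕ n ℚ.* ((q ℚ.- 0ℚ) ℚ.* (q ℚ.- 0ℚ))
sqdistBlock-replicate-unitVec {n} q zero =
  cong ((q ℚ.- 1ℚ) ℚ.* (q ℚ.- 1ℚ) ℚ.+_) (sqdistBlock-replicate n q 0ℚ)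
sqdistBlock-replicate-unitVec {suc n} q (suc a) = begin
  q₀² ℚ.+ sqdistBlock (replicate (suc n) q) (unitVec a)
    ≡⟨ cong (q₀² ℚ.+_) (sqdistBlock-replicate-unitVec q a) ⟩
  q₀² ℚ.+ (q₁² ℚ.+ fromℕ n ℚ.* q₀²)
    ≡⟨ solve 3 (λ a b x → a :+ (b :+ x :* a) := b :+ (con 1ℚ :+ x) :* a) refl q₀² q₁² (fromℕ n) ⟩
  q₁² ℚ.+ (1ℚ ℚ.+ fromℕ n) ℚ.* q₀² ∎
  where
  open ≡-Reasoning
  open +-*-Solver
  q₀² = (q ℚ.- 0ℚ) ℚ.* (q ℚ.- 0ℚ)
  q₁² = (q ℚ.- 1ℚ) ℚ.* (q ℚ.- 1ℚ)

sqdistBlock-0-unitVec : ∀ {n} (a : Fin n) → sqdistBlock (replicate n 0ℚ) (unitVec a) ≡ 1ℚ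
sqdistBlock-0-unitVec {suc n} a = trans (sqdistBlock-replicate-unitVec 0ℚ a)
  (trans (cong (1ℚ ℚ.+_) (ℚP.*-zeroʳ (fromℕ n))) (ℚP.+-identityʳ 1ℚ))

sqdistBlock-unitVec-≢ : ∀ {n} {a b : Fin n} → a ≢ b → sqdistBlock (unitVec a) (unitVec b) ≡ fromℕ 2
sqdistBlock-unitVec-≢ {a = zero}  {zero}  a≢b = ⊥-elim (a≢b refl)
sqdistBlock-unitVec-≢ {a = zero}  {suc b} _   = cong (1ℚ ℚ.+_) (sqdistBlock-0-unitVec b)
sqdistBlock-unitVec-≢ {a = suc a} {zero}  _   =
  cong (1ℚ ℚ.+_) (trans (sqdistBlock-sym (unitVec a) _) (sqdistBlock-0-unitVec a))
sqdistBlock-unitVec-≢ {a = suc a} {suc b} a≢b =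
  trans (ℚP.+-identityˡ _) (sqdistBlock-unitVec-≢ (a≢b ∘ cong suc))

hamming : ∀ {n m} → (Fin m → Fin n) → (Fin m → Fin n) → ℕ
hamming {m = zero}  x y = 0
hamming {m = suc m} x y with x zero F.≟ y zero
... | yes _ = hamming (x ∘ suc) (y ∘ suc)
... | no  _ = suc (hamming (x ∘ suc) (y ∘ suc))

hamming-self : ∀ {n m} (x : Fin m → Fin n) → hamming x x ≡ 0
hamming-self {m = zero}  x = refl
hamming-self {m = suc m} x with x zero F.≟ x zero
... | yes _   = hamming-self (x ∘ suc)
... | no  x≢x = ⊥-elim (x≢x refl)

hamming≤ : ∀ {n m} (x y : Fin m → Fin n) → hamming x y ≤ m
hamming≤ {m = zero}  x y = z≤n
hamming≤ {m = suc m} x y with x zero F.≟ y zero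
... | yes _ = ℕP.m≤n⇒m≤1+n (hamming≤ (x ∘ suc) (y ∘ suc))
... | no  _ = s≤s (hamming≤ (x ∘ suc) (y ∘ suc))

hamming≡0⇒≗ : ∀ {n m} (x y : Fin m → Fin n) → hamming x y ≡ 0 → x ≗ y
hamming≡0⇒≗ {m = suc m} x y h≡0 j with x zero F.≟ y zero | j
... | yes x₀≡y₀ | zero  = x₀≡y₀
... | yes _     | suc j = hamming≡0⇒≗ (x ∘ suc) (y ∘ suc) h≡0 j
... | no  _     | _     with () ← h≡0

prefixOnes : ∀ {n m c} → c ≤ m → Fin m → Fin (2 + n)
prefixOnes z≤n       _       = zero
prefixOnes (s≤s _)   zero    = suc zero
prefixOnes (s≤s c≤m) (suc j) = prefixOnes c≤m j

hamming-zeros-prefixOnes : ∀ {n m c} (c≤m : c ≤ m) →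
  hamming {2 + n} (const zero) (prefixOnes c≤m) ≡ c
hamming-zeros-prefixOnes {n} {m} z≤n = hamming-self {2 + n} {m} (const zero)
hamming-zeros-prefixOnes (s≤s c≤m)   = cong suc (hamming-zeros-prefixOnes c≤m)

sqdist-tabulate-unitVec : ∀ {n m} (x y : Fin m → Fin n) →
  sqdist (tabulate (unitVec ∘ x)) (tabulate (unitVec ∘ y)) ≡ fromℕ (2 * hamming x y)
sqdist-tabulate-unitVec {m = zero}  x y = refl
sqdist-tabulate-unitVec {m = suc m} x y with x zero F.≟ y zero
... | yes x₀≡y₀ rewrite x₀≡y₀ | sqdistBlock-self (unitVec (y zero)) =
  trans (ℚP.+-identityˡ _) (sqdist-tabulate-unitVec (x ∘ suc) (y ∘ suc))
... | no  x₀≢y₀ rewrite sqdistBlock-unitVec-≢ x₀≢y₀ | sqdist-tabulate-unitVec (x ∘ suc) (y ∘ suc) =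
  trans (sym (fromℕ-+ 2 (2 * h))) (cong fromℕ (sym (ℕP.*-suc 2 h)))
  where h = hamming (x ∘ suc) (y ∘ suc)

hvec-++ : ∀ n m k (w : Fin (m + k) → Fin n) →
  hvec n (m + k) w ≡ hvec n m (w ∘ (_↑ˡ k)) ++ hvec n k (w ∘ (m ↑ʳ_))
hvec-++ n m k w
  rewrite hvec≡tabulate-unitVec n (m + k) w
        | hvec≡tabulate-unitVec n m (w ∘ (_↑ˡ k))
        | hvec≡tabulate-unitVec n k (w ∘ (m ↑ʳ_)) = tabulate-++ m (unitVec ∘ w)

hvec-cong : ∀ n m {x y : Fin m → Fin n} → x ≗ y → hvec n m x ≡ hvec n m y
hvec-cong n m {x} {y} x≗y rewrite hvec≡tabulate-unitVec n m x | hvec≡tabulate-unitVec n m y =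
  VP.tabulate-cong (cong unitVec ∘ x≗y)

sqdist-hvec : ∀ n m (x y : Fin m → Fin n) → sqdist (hvec n m x) (hvec n m y) ≡ fromℕ (2 * hamming x y)
sqdist-hvec n m x y rewrite hvec≡tabulate-unitVec n m x | hvec≡tabulate-unitVec n m y =
  sqdist-tabulate-unitVec x y

-- [2, 4, …, 2m], the squared distances of Ĥ(n,m)
evens : ℕ → List ℚ
evens m = L.map (λ j → fromℕ (2 * suc j)) (upTo m)

length-evens : ∀ m → length (evens m) ≡ m
length-evens m = trans (LP.length-map _ (upTo m)) (LP.length-upTo m)

evens-unique : ∀ m → Unique (evens m)
evens-unique m = Unique.map⁺ (ℕP.suc-injective ∘ fromℕ-double-injective) (Unique.upTo⁺ m)

∈-evens⁺ : ∀ {m c} → 1 ≤ c → c ≤ m → fromℕ (2 * c) ∈ evens m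
∈-evens⁺ (s≤s z≤n) c≤m = ∈-map⁺ (λ j → fromℕ (2 * suc j)) (∈-upTo⁺ c≤m)

∈-evens⁻ : ∀ {m r} → r ∈ evens m → ∃ λ c → 1 ≤ c × c ≤ m × r ≡ fromℕ (2 * c)
∈-evens⁻ r∈evens with j , j∈upTo , refl ← ∈-map⁻ (λ j → fromℕ (2 * suc j)) r∈evens =
  suc j , s≤s z≤n , ∈-upTo⁻ j∈upTo , refl

sqdist≡double⇒≢ : ∀ {n m c} {p q : Point n m} → 1 ≤ c → sqdist p q ≡ fromℕ (2 * c) → p ≢ q
sqdist≡double⇒≢ {c = c} {p = p} (s≤s z≤n) pq≡2c refl
  with () ← fromℕ-double-injective {a = c} {b = 0} (trans (sym pq≡2c) (sqdist-self p))

Ĥ-realises : ∀ {n m c} → 1 ≤ c → c ≤ m → IsDist (InH (2 + n) m) (fromℕ (2 * c))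
Ĥ-realises {n} {m} {c} 1≤c c≤m =
  hvec (2 + n) m (const zero) , hvec (2 + n) m (prefixOnes c≤m) ,
  (const zero , refl) , (prefixOnes c≤m , refl) , sqdist≡double⇒≢ 1≤c dist , dist
  where
  dist : sqdist (hvec (2 + n) m (const zero)) (hvec (2 + n) m (prefixOnes c≤m)) ≡ fromℕ (2 * c)
  dist = trans (sqdist-hvec (2 + n) m _ _) (cong (λ h → fromℕ (2 * h)) (hamming-zeros-prefixOnes c≤m))

evens-realised : ∀ {n m} {S : Point (2 + n) m → Set} → (∀ {p} → InH (2 + n) m p → S p) →
  ∀ {r} → r ∈ evens m → IsDist S r
evens-realised Ĥ⊆S r∈evens with c , 1≤c , c≤m , refl ← ∈-evens⁻ r∈evens =
  IsDist-mono Ĥ⊆S (Ĥ-realises 1≤c c≤m)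

sqdist-distinct-hvec : ∀ n m (x y : Fin m → Fin n) → hvec n m x ≢ hvec n m y →
  sqdist (hvec n m x) (hvec n m y) ∈ evens m
sqdist-distinct-hvec n m x y x≢y rewrite sqdist-hvec n m x y with hamming x y in h≡ | hamming≤ x y
... | zero  | _   = ⊥-elim (x≢y (hvec-cong n m (hamming≡0⇒≗ x y h≡)))
... | suc h | h≤m = ∈-evens⁺ (s≤s z≤n) h≤m

CanAdd⇒sqdist-hvec : ∀ {n m} {x : Point (2 + n) m} → CanAdd (2 + n) m x →
  ∀ w → ∃ λ c → c ≤ m × sqdist x (hvec (2 + n) m w) ≡ fromℕ (2 * c)
CanAdd⇒sqdist-hvec {n} {m} {x} canAdd w with VP.≡-dec (VP.≡-dec ℚP._≟_) x (hvec (2 + n) m w)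
... | yes refl = 0 , z≤n , sqdist-self x
... | no  x≢w
  with c , _ , c≤m , eq ← ∈-evens⁻ (IsSDistanceSet-⊆ canAdd (evens-unique m) (length-evens m) (evens-realised inj₁)
                                     (x , hvec (2 + n) m w , inj₂ refl , inj₁ (w , refl) , x≢w , refl)) =
  c , c≤m , eq

CanAdd-++ : ∀ {n m k b} {x : Point (2 + n) m} (y : Point (2 + n) k) → 1 ≤ b → b ≤ k →
  (∀ w → sqdist y (hvec (2 + n) k w) ≡ fromℕ (2 * b)) →
  CanAdd (2 + n) m x → CanAdd (2 + n) (m + k) (x ++ y)
CanAdd-++ {n} {m} {k} {b} {x} y 1≤b b≤k y-dist canAdd =
  evens (m + k) , length-evens (m + k) , evens-unique (m + k) , λ r → mk⇔ listed (evens-realised inj₁)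
  where
  N = 2 + n
  xy-dist : ∀ w → sqdist (x ++ y) (hvec N (m + k) w) ∈ evens (m + k)
  xy-dist w with c , c≤m , x-dist ← CanAdd⇒sqdist-hvec canAdd (w ∘ (_↑ˡ k)) =
    subst (_∈ evens (m + k)) (sym split)
      (∈-evens⁺ (ℕP.≤-trans 1≤b (ℕP.m≤n+m b c)) (ℕP.+-mono-≤ c≤m b≤k))
    where
    open ≡-Reasoning
    split : sqdist (x ++ y) (hvec N (m + k) w) ≡ fromℕ (2 * (c + b))
    split = begin
      sqdist (x ++ y) (hvec N (m + k) w)
        ≡⟨ cong (sqdist (x ++ y)) (hvec-++ N m k w) ⟩
      sqdist (x ++ y) (hvec N m (w ∘ (_↑ˡ k)) ++ hvec N k (w ∘ (m ↑ʳ_)))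
        ≡⟨ sqdist-++ x _ y _ ⟩
      sqdist x (hvec N m (w ∘ (_↑ˡ k))) ℚ.+ sqdist y (hvec N k (w ∘ (m ↑ʳ_)))
        ≡⟨ cong₂ ℚ._+_ x-dist (y-dist (w ∘ (m ↑ʳ_))) ⟩
      fromℕ (2 * c) ℚ.+ fromℕ (2 * b)
        ≡⟨ fromℕ-double-+ c b ⟩
      fromℕ (2 * (c + b)) ∎
  listed : ∀ {r} → IsDist (λ p → InH N (m + k) p ⊎ p ≡ x ++ y) r → r ∈ evens (m + k)
  listed (_ , _ , inj₁ (w , refl) , inj₁ (w′ , refl) , p≢q , refl) =
    sqdist-distinct-hvec N (m + k) w w′ p≢q
  listed (_ , _ , inj₁ (w , refl) , inj₂ refl , _ , refl) =
    subst (_∈ evens (m + k)) (sqdist-sym (x ++ y) (hvec N (m + k) w)) (xy-dist w)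
  listed (_ , _ , inj₂ refl , inj₁ (w , refl) , _ , refl) = xy-dist w
  listed (_ , _ , inj₂ refl , inj₂ refl , p≢q , _) = ⊥-elim (p≢q refl)

sqdistBlock-uvec-unitVec : ∀ n (a : Fin (suc n)) →
  sqdistBlock (uvec (suc n)) (unitVec a) ≡ 1ℚ ℚ.- divℕ 1 (suc n)
sqdistBlock-uvec-unitVec n a = begin
  sqdistBlock (replicate (suc n) u) (unitVec a)
    ≡⟨ sqdistBlock-replicate-unitVec u a ⟩
  (u ℚ.- 1ℚ) ℚ.* (u ℚ.- 1ℚ) ℚ.+ fromℕ n ℚ.* ((u ℚ.- 0ℚ) ℚ.* (u ℚ.- 0ℚ))
    ≡⟨ solve 2 (λ u x → (u :- con 1ℚ) :* (u :- con 1ℚ) :+ x :* ((u :- con 0ℚ) :* (u :- con 0ℚ))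
                        := u :* ((con 1ℚ :+ x) :* u) :- u :- u :+ con 1ℚ) refl u (fromℕ n) ⟩
  u ℚ.* (fromℕ (suc n) ℚ.* u) ℚ.- u ℚ.- u ℚ.+ 1ℚ
    ≡⟨ cong (λ t → u ℚ.* t ℚ.- u ℚ.- u ℚ.+ 1ℚ) (fromℕ-*-divℕ n) ⟩
  u ℚ.* 1ℚ ℚ.- u ℚ.- u ℚ.+ 1ℚ
    ≡⟨ solve 1 (λ u → u :* con 1ℚ :- u :- u :+ con 1ℚ := con 1ℚ :- u) refl u ⟩
  1ℚ ℚ.- u ∎
  where
  open ≡-Reasoning
  open +-*-Solver
  u = divℕ 1 (suc n)

sqdist-replicate-hvec : ∀ {n} k (v : Vec ℚ n) d → (∀ a → sqdistBlock v (unitVec a) ≡ d) →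
  ∀ w → sqdist (replicate k v) (hvec n k w) ≡ fromℕ k ℚ.* d
sqdist-replicate-hvec {n} k v d v-dist w rewrite hvec≡tabulate-unitVec n k w = go k w
  where
  go : ∀ k (w : Fin k → Fin n) → sqdist (replicate k v) (tabulate (unitVec ∘ w)) ≡ fromℕ k ℚ.* d
  go zero    w = sym (ℚP.*-zeroˡ d)
  go (suc k) w = begin
    sqdistBlock v (unitVec (w zero)) ℚ.+ sqdist (replicate k v) (tabulate (unitVec ∘ w ∘ suc))
      ≡⟨ cong₂ ℚ._+_ (v-dist (w zero)) (go k (w ∘ suc)) ⟩
    d ℚ.+ fromℕ k ℚ.* d
      ≡⟨ solve 2 (λ d x → d :+ x :* d := (con 1ℚ :+ x) :* d) refl d (fromℕ k) ⟩
    (1ℚ ℚ.+ fromℕ k) ℚ.* d ∎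
    where
    open ≡-Reasoning
    open +-*-Solver

sqdist-uvecs-hvec : ∀ n i w →
  sqdist (replicate (i * suc n) (uvec (suc n))) (hvec (suc n) (i * suc n) w) ≡ fromℕ (i * n)
sqdist-uvecs-hvec n i w = begin
  sqdist (replicate (i * suc n) (uvec (suc n))) (hvec (suc n) (i * suc n) w)
    ≡⟨ sqdist-replicate-hvec (i * suc n) (uvec (suc n)) _ (sqdistBlock-uvec-unitVec n) w ⟩
  fromℕ (i * suc n) ℚ.* (1ℚ ℚ.- u)
    ≡⟨ cong (ℚ._* (1ℚ ℚ.- u)) (fromℕ-* i (suc n)) ⟩
  fromℕ i ℚ.* fromℕ (suc n) ℚ.* (1ℚ ℚ.- u)
    ≡⟨ solve 3 (λ a x u → a :* (con 1ℚ :+ x) :* (con 1ℚ :- u)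
                       := a :* (con 1ℚ :+ x) :- a :* ((con 1ℚ :+ x) :* u)) refl (fromℕ i) (fromℕ n) u ⟩
  fromℕ i ℚ.* fromℕ (suc n) ℚ.- fromℕ i ℚ.* (fromℕ (suc n) ℚ.* u)
    ≡⟨ cong (λ t → fromℕ i ℚ.* fromℕ (suc n) ℚ.- fromℕ i ℚ.* t) (fromℕ-*-divℕ n) ⟩
  fromℕ i ℚ.* fromℕ (suc n) ℚ.- fromℕ i ℚ.* 1ℚ
    ≡⟨ solve 2 (λ a x → a :* (con 1ℚ :+ x) :- a :* con 1ℚ := a :* x) refl (fromℕ i) (fromℕ n) ⟩
  fromℕ i ℚ.* fromℕ n
    ≡⟨ fromℕ-* i n ⟨
  fromℕ (i * n) ∎
  where
  open ≡-Reasoning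
  open +-*-Solver
  u = divℕ 1 (suc n)

even⊎odd : ∀ k → 2 ∣ k ⊎ 2 ∣ suc k
even⊎odd zero    = inj₁ (divides 0 refl)
even⊎odd (suc k) with even⊎odd k
... | inj₁ (divides q eq) = inj₂ (divides (suc q) (cong (_+_ 2) eq))
... | inj₂ 2∣1+k          = inj₁ 2∣1+k

2∣i*[1+n] : ∀ n i → (2 ∣ 2 + n → 2 ∣ i) → 2 ∣ i * suc n
2∣i*[1+n] n i 2∣n⇒2∣i with even⊎odd (suc n)
... | inj₁ 2∣1+n = ∣n⇒∣m*n i 2∣1+n
... | inj₂ 2∣2+n = ∣m⇒∣m*n (suc n) (2∣n⇒2∣i 2∣2+n)

halve-i*[1+n] : ∀ n i → 1 ≤ i → (2 ∣ 2 + n → 2 ∣ i) →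
  ∃ λ b → 1 ≤ b × b ≤ i * (2 + n) × i * suc n ≡ 2 * b
halve-i*[1+n] n i 1≤i 2∣n⇒2∣i =
  let divides b i[1+n]≡b*2 = 2∣i*[1+n] n i 2∣n⇒2∣i
      i[1+n]≡2b = trans i[1+n]≡b*2 (ℕP.*-comm b 2)
  in b , 1≤b b (subst (1 ≤_) i[1+n]≡2b (ℕP.*-mono-≤ 1≤i (s≤s z≤n))) ,
     ℕP.≤-trans (ℕP.m≤m+n b (b + 0))
       (subst (_≤ i * (2 + n)) i[1+n]≡2b (ℕP.*-monoʳ-≤ i (ℕP.n≤1+n (suc n)))) ,
     i[1+n]≡2b
  where
  1≤b : ∀ b → 1 ≤ 2 * b → 1 ≤ b
  1≤b (suc b) _ = s≤s z≤n

proposition4p7 : (n m i : ℕ) → 2 ≤ n → 1 ≤ m → 1 ≤ i → (2 ∣ n → 2 ∣ i)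
    → (t : Fin m → ℕ) → (∀ j → 1 ≤ t j)
    → (k : (j : Fin m) → Vec ℕ (t j)) → (∀ j → sum (k j) ≡ n)
    → (∀ x → InX n m t k x → CanAdd n m x)
    → ∀ x → InX n m t k x
    → CanAdd n (m + i * n) (x ++ replicate (i * n) (uvec n))
proposition4p7 (suc (suc n)) m i (s≤s (s≤s z≤n)) _ 1≤i 2∣n⇒2∣i _ _ _ _ 𝔛⊆CanAdd x x∈𝔛
  with b , 1≤b , b≤K , i[n-1]≡2b ← halve-i*[1+n] n i 1≤i 2∣n⇒2∣i =
  CanAdd-++ (replicate (i * suc (suc n)) (uvec (suc (suc n)))) 1≤b b≤K
    (λ w → trans (sqdist-uvecs-hvec (suc n) i w) (cong fromℕ i[n-1]≡2b))
    (𝔛⊆CanAdd x x∈𝔛)
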